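{- Let $k$ be an integer and let $a_k(n)$ be the number of $k$-Arndt compositions of $n$ (with $a_k(0)=1$). Then $$\sum_{n\ge0}a_k(n)x^n=\begin{cases} \dfrac{1 - x^2}{1 - x - x^2 + x^3 - x^{k+3}},& \text{if } k\geq 0,\\[2ex] \dfrac{1 - x^2}{1 - x - 2 x^2 + x^{2 - k}},& \text{if } k< 0. \end{cases}$$
   Context: A composition of $n\ge0$ is a finite sequence $(\sigma_1,\dots,\sigma_\ell)$ of positive integers summing to $n$ (the empty composition is the composition of $0$). For an integer $k$, a $k$-Arndt composition is a composition satisfying $\sigma_{2i-1}>\sigma_{2i}+k$ for every positive integer $i$ with $2i\le \ell$. -}

module Defs where

open import Data.Nat using (ℕ; zero; suc; _<_; _∸_; _≡ᵇ_)
import Data.Nat as ℕ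
open import Data.Integer using (ℤ; +_; -[1+_]; _+_; _*_; -_; 0ℤ; 1ℤ)
import Data.Integer as ℤ
open import Data.List using (List; []; _∷_; length; map; foldr; upTo)
open import Data.List.Relation.Unary.All using (All)
open import Data.Nat.ListAction using (sum)
open import Data.List.Relation.Unary.Unique.Propositional using (Unique)
open import Data.List.Membership.Propositional using (_∈_)
open import Data.Product using (Σ; _×_)
open import Data.Unit using (⊤)
open import Data.Bool using (if_then_else_)
open import Function.Bundles using (_⇔_)
open import Relation.Binary.PropositionalEquality using (_≡_)

IsComposition : ℕ → List ℕ → Set
IsComposition n σ = All (λ x → 0 < x) σ × sum σ ≡ n

IsArndt : ℤ → List ℕ → Set
IsArndt k []            = ⊤
IsArndt k (x ∷ [])      = ⊤
IsArndt k (x ∷ y ∷ rest) = ((+ y) + k ℤ.< (+ x)) × IsArndt k rest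

IsArndtComposition : ℤ → ℕ → List ℕ → Set
IsArndtComposition k n σ = IsComposition n σ × IsArndt k σ

IsArndtCount : ℤ → ℕ → ℕ → Set
IsArndtCount k n m =
  Σ (List (List ℕ)) λ L →
    Unique L × (∀ σ → (σ ∈ L) ⇔ IsArndtComposition k n σ) × length L ≡ m

-- Polynomials with integer coefficients as lists of monomials (coefficient, exponent)
Poly : Set
Poly = List (ℤ × ℕ)

open import Data.Product using (_,_)

sumℤ : List ℤ → ℤ
sumℤ = foldr _+_ 0ℤ

coeff : Poly → ℕ → ℤ
coeff p j = sumℤ (map (λ { (c , e) → if e ≡ᵇ j then c else 0ℤ }) p)

X^ : ℕ → ℤ × ℕ
X^ e = (1ℤ , e)

negX^ : ℕ → ℤ × ℕ
negX^ e = (- 1ℤ , e)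

numerator : Poly
numerator = X^ 0 ∷ negX^ 2 ∷ []

denominator : ℤ → Poly
denominator (+ k)    = X^ 0 ∷ negX^ 1 ∷ negX^ 2 ∷ X^ 3 ∷ negX^ (k ℕ.+ 3) ∷ []
denominator -[1+ m ] = X^ 0 ∷ negX^ 1 ∷ negX^ 2 ∷ negX^ 2 ∷ X^ (2 ℕ.+ suc m) ∷ [] -- k = -(m+1) < 0, 2 - k = 2 + (m+1)

convCoeff : Poly → (ℕ → ℕ) → ℕ → ℤ
convCoeff p a n = sumℤ (map (λ j → coeff p j * + a (n ∸ j)) (upTo (suc n)))

{-# OPTIONS --safe #-}
-- Cut a k-Arndt composition after its first two parts (x, y). Writing A(z) = Σ a_k(n) zⁿ and
-- P_Π(z) = Σ_{(x,y) ∈ Π} z^(x+y) for a region Π of pairs, the compositions whose first pair lies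
-- in Π have series P_Π · A, and A = 1/(1 − z) + P_Π · A for Π = {y + k < x}. Translating a region
-- by (dx, dy) multiplies its series by z^(dx+dy); as Π is invariant under the diagonal translation,
-- P_Π = z² P_Π + P_∂ where ∂ is the part of Π in the first row or column: the ray {y = 1, x ≥ k + 2}
-- if k ≥ 0, and the ray {y = 1} plus the segment {x = 1, 2 ≤ y ≤ −k} (a difference of two
-- column rays) if k < 0. A ray R starting at (x₀, y₀) satisfies P_R = z P_R + z^(x₀+y₀).
-- Eliminating these relations coefficientwise leaves (denominator) · A = 1 − z².

module Submission where

open import Defs
open import Data.Nat using (ℕ)
open import Data.Integer using (ℤ; +_; -[1+_])
open import Data.Product using (Σ; _×_; _,_)
open import Relation.Binary.PropositionalEquality using (_≡_; refl)

module Delay where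

  open import Data.Nat using (zero; suc; _<_; z≤n; s≤s)
  import Data.Nat as ℕ
  open import Data.Integer using (0ℤ; _+_)
  open import Relation.Binary.PropositionalEquality using (trans)

  -- delay j F lists the coefficients of z^j · Σ F(n) zⁿ.
  delay : ℕ → (ℕ → ℤ) → ℕ → ℤ
  delay zero    f n       = f n
  delay (suc j) f zero    = 0ℤ
  delay (suc j) f (suc n) = delay j f n

  shifted⇒≡delay : ∀ d {f g : ℕ → ℤ} →
                   (∀ r → f (d ℕ.+ r) ≡ g r) → (∀ n → n < d → f n ≡ 0ℤ) →
                   ∀ n → f n ≡ delay d g n
  shifted⇒≡delay zero    above below n       = above n
  shifted⇒≡delay (suc d) above below zero    = below zero (s≤s z≤n)
  shifted⇒≡delay (suc d) above below (suc n) =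
    shifted⇒≡delay d above (λ n n<d → below (suc n) (s≤s n<d)) n

  delay-cong : ∀ j {f g : ℕ → ℤ} → (∀ n → f n ≡ g n) → ∀ n → delay j f n ≡ delay j g n
  delay-cong zero    f≗g n       = f≗g n
  delay-cong (suc j) f≗g zero    = refl
  delay-cong (suc j) f≗g (suc n) = delay-cong j f≗g n

  delay-distrib-+ : ∀ j (f g : ℕ → ℤ) n → delay j (λ i → f i + g i) n ≡ delay j f n + delay j g n
  delay-distrib-+ zero    f g n       = refl
  delay-distrib-+ (suc j) f g zero    = refl
  delay-distrib-+ (suc j) f g (suc n) = delay-distrib-+ j f g n

  delay-cong-+ : ∀ {f g h : ℕ → ℤ} → (∀ n → f n ≡ g n + h n) →
                 ∀ j n → delay j f n ≡ delay j g n + delay j h n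
  delay-cong-+ {g = g} {h} f≡g+h j n = trans (delay-cong j f≡g+h n) (delay-distrib-+ j g h n)

  delay-delay : ∀ i j (f : ℕ → ℤ) n → delay i (delay j f) n ≡ delay (i ℕ.+ j) f n
  delay-delay zero    j f n       = refl
  delay-delay (suc i) j f zero    = refl
  delay-delay (suc i) j f (suc n) = delay-delay i j f n

module Enumerations where

  open import Data.Nat using (_<_; _+_)
  open import Data.Nat.Properties using (+-cancelˡ-≡; m≤m+n; <⇒≱)
  open import Data.List using (List; []; length; map; filter; _++_)
  open import Data.List.Properties using (length-map; length-++)
  open import Data.List.Relation.Unary.Unique.Propositional using (Unique; [])
  import Data.List.Relation.Unary.Unique.Propositional.Properties as Unique
  open import Data.List.Membership.Propositional using (_∈_)
  open import Data.List.Membership.Propositional.Properties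
    using (∈-map⁺; ∈-map⁻; ∈-++⁺ˡ; ∈-++⁺ʳ; ∈-++⁻; ∈-filter⁺; ∈-filter⁻)
  open import Data.List.Membership.Propositional.Properties.WithK using (unique∧set⇒bag)
  open import Data.List.Relation.Binary.BagAndSetEquality using (∼bag⇒↭)
  open import Data.List.Relation.Binary.Permutation.Propositional.Properties using (↭-length)
  open import Data.Product using (proj₁; proj₂; ∃; ∃₂)
  open import Data.Sum using (_⊎_; inj₁; inj₂; [_,_])
  open import Data.Empty using (⊥-elim)
  open import Relation.Nullary using (¬_)
  open import Relation.Unary using (Decidable)
  open import Relation.Binary.PropositionalEquality using (trans; cong)
  open import Function using (_∘_)
  open import Function.Bundles using (_⇔_; mk⇔; Equivalence)
  import Function.Properties.Equivalence as ⇔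
  open import Function.Definitions using (Injective)
  open Equivalence using (to; from)
  open Delay

  Enumeration : {A : Set} → (A → Set) → Set
  Enumeration {A} P = Σ (List A) λ xs → Unique xs × (∀ x → x ∈ xs ⇔ P x)

  module _ {A : Set} where

    size : {P : A → Set} → Enumeration P → ℕ
    size = length ∘ proj₁

    size-unique : {P : A → Set} (e e′ : Enumeration P) → size e ≡ size e′
    size-unique (xs , xs! , ∈xs) (ys , ys! , ∈ys) =
      ↭-length (∼bag⇒↭ (unique∧set⇒bag xs! ys! (λ {x} → ⇔.trans (∈xs x) (⇔.sym (∈ys x)))))

    enumerate-⇔ : {P Q : A → Set} → (∀ x → P x ⇔ Q x) → Enumeration P → Enumeration Q
    enumerate-⇔ P⇔Q (xs , xs! , ∈xs) = xs , xs! , λ x → ⇔.trans (∈xs x) (P⇔Q x)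

    enumerate-filter : {P Q : A → Set} → Decidable Q → (∀ x → Q x → P x) → Enumeration P → Enumeration Q
    enumerate-filter Q? Q⊆P (xs , xs! , ∈xs) =
      filter Q? xs , Unique.filter⁺ Q? xs! ,
      λ x → mk⇔ (proj₂ ∘ ∈-filter⁻ Q? {xs = xs}) (λ Qx → ∈-filter⁺ Q? (from (∈xs x) (Q⊆P x Qx)) Qx)

    enumerate-∅ : {P : A → Set} → (∀ x → ¬ P x) → Enumeration P
    enumerate-∅ ¬P = [] , [] , λ x → mk⇔ (λ ()) (⊥-elim ∘ ¬P x)

    module _ {P Q : A → Set} (P∩Q=∅ : ∀ x → P x → ¬ Q x) where

      enumerate-⊎ : Enumeration P → Enumeration Q → Enumeration (λ x → P x ⊎ Q x)
      enumerate-⊎ (xs , xs! , ∈xs) (ys , ys! , ∈ys) =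
        xs ++ ys , Unique.++⁺ xs! ys! disjoint , λ x → mk⇔ (split x) (join x)
        where
        disjoint : ∀ {x} → ¬ (x ∈ xs × x ∈ ys)
        disjoint {x} (x∈xs , x∈ys) = P∩Q=∅ x (to (∈xs x) x∈xs) (to (∈ys x) x∈ys)
        split : ∀ x → x ∈ xs ++ ys → P x ⊎ Q x
        split x x∈ = [ inj₁ ∘ to (∈xs x) , inj₂ ∘ to (∈ys x) ] (∈-++⁻ xs x∈)
        join : ∀ x → P x ⊎ Q x → x ∈ xs ++ ys
        join x = [ ∈-++⁺ˡ ∘ from (∈xs x) , ∈-++⁺ʳ xs ∘ from (∈ys x) ]

      size-⊎ : (e : Enumeration P) (e′ : Enumeration Q) → size (enumerate-⊎ e e′) ≡ size e + size e′
      size-⊎ (xs , _) _ = length-++ xs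

    module _ {P : A → Set} (f : A → A) (f-inj : Injective _≡_ _≡_ f) where

      enumerate-image : Enumeration P → Enumeration (λ y → ∃ λ x → P x × y ≡ f x)
      enumerate-image (xs , xs! , ∈xs) = map f xs , Unique.map⁺ f-inj xs! , λ y → mk⇔ preimage image
        where
        preimage : ∀ {y} → y ∈ map f xs → ∃ λ x → P x × y ≡ f x
        preimage y∈ with ∈-map⁻ f y∈
        ... | x , x∈xs , refl = x , to (∈xs x) x∈xs , refl
        image : ∀ {y} → (∃ λ x → P x × y ≡ f x) → y ∈ map f xs
        image (x , Px , refl) = ∈-map⁺ f (from (∈xs x) Px)

      size-image : (e : Enumeration P) → size (enumerate-image e) ≡ size e
      size-image (xs , _) = length-map f xs

    size-reindex : {P Q : ℕ → A → Set} (f : A → A) → Injective _≡_ _≡_ f → (d : ℕ) →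
                   (∀ N x → P N x ⇔ (∃₂ λ r y → N ≡ d + r × Q r y × x ≡ f y)) →
                   (eP : ∀ N → Enumeration (P N)) (eQ : ∀ r → Enumeration (Q r)) →
                   ∀ N → + size (eP N) ≡ delay d (λ r → + size (eQ r)) N
    size-reindex {P} {Q} f f-inj d P⇔ eP eQ = shifted⇒≡delay d above below
      where
      above : ∀ r → + size (eP (d + r)) ≡ + size (eQ r)
      above r = cong +_ (trans (size-unique (eP (d + r)) (enumerate-⇔ image⇔ (enumerate-image f f-inj (eQ r))))
                               (size-image f f-inj (eQ r)))
        where
        back : ∀ {x} → P (d + r) x → ∃ λ y → Q r y × x ≡ f y
        back {x} Px with to (P⇔ (d + r) x) Px
        ... | r′ , y , d+r≡d+r′ , Qr′y , x≡fy with +-cancelˡ-≡ d r r′ d+r≡d+r′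
        ... | refl = y , Qr′y , x≡fy
        image⇔ : ∀ x → (∃ λ y → Q r y × x ≡ f y) ⇔ P (d + r) x
        image⇔ x = mk⇔ (λ (y , Qy , x≡fy) → from (P⇔ (d + r) x) (r , y , refl , Qy , x≡fy)) back
      below : ∀ N → N < d → + size (eP N) ≡ + 0
      below N N<d = cong +_ (size-unique (eP N) (enumerate-∅ λ x Px → outside (to (P⇔ N x) Px)))
        where
        outside : ∀ {x} → ¬ (∃₂ λ r y → N ≡ d + r × Q r y × x ≡ f y)
        outside (r , _ , refl , _) = <⇒≱ N<d (m≤m+n d r)

module Compositions where

  open import Data.Nat using (zero; suc; z≤n; s≤s)
  open import Data.Nat.Properties using (suc-injective)
  open import Data.List using (List; []; _∷_; map; _++_)
  open import Data.List.Relation.Unary.All using ([]; _∷_)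
  open import Data.List.Relation.Unary.Unique.Propositional using (Unique; []; _∷_)
  import Data.List.Relation.Unary.Unique.Propositional.Properties as Unique
  open import Data.List.Membership.Propositional using (_∈_)
  open import Data.List.Membership.Propositional.Properties using (∈-map⁺; ∈-map⁻; ∈-++⁺ˡ; ∈-++⁺ʳ; ∈-++⁻)
  open import Data.List.Relation.Unary.Any using (here)
  open import Data.Sum using ([_,_])
  open import Relation.Nullary using (¬_)
  open import Relation.Binary.PropositionalEquality using (cong)
  open import Function.Bundles using (mk⇔)
  open Enumerations

  incrementHead : List ℕ → List ℕ
  incrementHead []      = []
  incrementHead (x ∷ σ) = suc x ∷ σ

  -- A composition of n + 2 either starts with 1 or is one of n + 1 with its first part increased.
  compositions : ℕ → List (List ℕ)
  compositions zero          = [] ∷ []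
  compositions (suc zero)    = (1 ∷ []) ∷ []
  compositions (suc (suc n)) = map (1 ∷_) (compositions (suc n)) ++ map incrementHead (compositions (suc n))

  prepend-one : ∀ {n τ} → IsComposition n τ → IsComposition (suc n) (1 ∷ τ)
  prepend-one (τ>0 , Στ) = s≤s z≤n ∷ τ>0 , cong suc Στ

  incrementHead-composition : ∀ {n τ} → IsComposition (suc n) τ → IsComposition (suc (suc n)) (incrementHead τ)
  incrementHead-composition {τ = _ ∷ _} (_ ∷ ρ>0 , Στ) = s≤s z≤n ∷ ρ>0 , cong suc Στ

  compositions-sound-step : ∀ n → (∀ {τ} → τ ∈ compositions (suc n) → IsComposition (suc n) τ) →
                            ∀ {σ} → σ ∈ compositions (suc (suc n)) → IsComposition (suc (suc n)) σ
  compositions-sound-step n sound {σ} σ∈ =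
    [ prepended , incremented ] (∈-++⁻ (map (1 ∷_) (compositions (suc n))) σ∈)
    where
    prepended : σ ∈ map (1 ∷_) (compositions (suc n)) → IsComposition (suc (suc n)) σ
    prepended σ∈₁ with ∈-map⁻ (1 ∷_) σ∈₁
    ... | _ , τ∈ , refl = prepend-one (sound τ∈)
    incremented : σ ∈ map incrementHead (compositions (suc n)) → IsComposition (suc (suc n)) σ
    incremented σ∈₂ with ∈-map⁻ incrementHead σ∈₂
    ... | _ , τ∈ , refl = incrementHead-composition (sound τ∈)

  compositions-sound : ∀ n {σ} → σ ∈ compositions n → IsComposition n σ
  compositions-sound zero          (here refl) = [] , refl
  compositions-sound (suc zero)    (here refl) = s≤s z≤n ∷ [] , refl
  compositions-sound (suc (suc n)) = compositions-sound-step n (compositions-sound (suc n))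

  compositions-complete : ∀ n {σ} → IsComposition n σ → σ ∈ compositions n
  compositions-complete zero          {[]}        _                   = here refl
  compositions-complete zero          {_ ∷ _}     (s≤s _ ∷ _ , ())
  compositions-complete (suc zero)    {1 ∷ []}    _                   = here refl
  compositions-complete (suc zero)    {1 ∷ _ ∷ _} (_ ∷ s≤s _ ∷ _ , ())
  compositions-complete (suc (suc n)) {1 ∷ ρ}     (_ ∷ ρ>0 , Σσ)      =
    ∈-++⁺ˡ (∈-map⁺ (1 ∷_) (compositions-complete (suc n) (ρ>0 , suc-injective Σσ)))
  compositions-complete (suc (suc n)) {suc (suc x) ∷ ρ} (_ ∷ ρ>0 , Σσ) =
    ∈-++⁺ʳ (map (1 ∷_) (compositions (suc n)))
      (∈-map⁺ incrementHead (compositions-complete (suc n) {suc x ∷ ρ} (s≤s z≤n ∷ ρ>0 , suc-injective Σσ)))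

  compositions-unique : ∀ n → Unique (compositions n)
  compositions-unique zero          = [] ∷ []
  compositions-unique (suc zero)    = [] ∷ []
  compositions-unique (suc (suc n)) =
    Unique.++⁺ (Unique.map⁺ (λ { refl → refl }) (compositions-unique (suc n)))
               (Unique.map⁺ incrementHead-injective (compositions-unique (suc n))) disjoint
    where
    incrementHead-injective : ∀ {σ τ} → incrementHead σ ≡ incrementHead τ → σ ≡ τ
    incrementHead-injective {[]}    {[]}    _    = refl
    incrementHead-injective {_ ∷ _} {_ ∷ _} refl = refl
    disjoint : ∀ {σ} → ¬ (σ ∈ map (1 ∷_) (compositions (suc n)) × σ ∈ map incrementHead (compositions (suc n)))
    disjoint (σ∈₁ , σ∈₂) with ∈-map⁻ (1 ∷_) σ∈₁ | ∈-map⁻ incrementHead σ∈₂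
    ... | _ , _ , refl | _ , τ∈ , σ≡ = head-not-one (compositions-sound (suc n) τ∈) σ≡
      where
      head-not-one : ∀ {τ ρ} → IsComposition (suc n) τ → ¬ (1 ∷ ρ ≡ incrementHead τ)
      head-not-one {_ ∷ _} (s≤s _ ∷ _ , _) ()

  enumerate-compositions : ∀ n → Enumeration (IsComposition n)
  enumerate-compositions n =
    compositions n , compositions-unique n ,
    λ σ → mk⇔ (compositions-sound n) (compositions-complete n)

module FirstPairs (k : ℤ) where

  open import Level using (0ℓ)
  open import Data.Nat using (zero; suc; _<_; _≤_; _+_; _∸_; z≤n; s≤s; _≟_; _<?_; _≤?_)
  open import Data.Nat.Properties
    using ( +-assoc; +-identityʳ; m+n∸m≡n; m+[n∸m]≡n; m<n⇒0<n∸m; <⇒≤; m≤n⇒m≤o+n; m≤n⇒m<n∨m≡n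
          ; <-irrefl; ≤-refl; ≤-trans)
  open import Data.Nat.Tactic.RingSolver using (solve-∀)
  open import Data.Nat.ListAction using (sum)
  import Data.Integer as ℤ
  open import Data.Integer using (1ℤ)
  open import Data.List using (List; []; _∷_)
  open import Data.List.Relation.Unary.All using (all?; []; _∷_)
  open import Data.List.Relation.Unary.Unique.Propositional using ([]; _∷_)
  open import Data.List.Relation.Unary.Any using (here; there)
  open import Data.Product using (proj₁; proj₂; ∃; ∃₂)
  open import Data.Sum using (_⊎_; inj₁; inj₂; [_,_])
  open import Data.Empty using (⊥)
  open import Data.Unit using (tt)
  open import Relation.Nullary using (¬_; Dec; yes; no)
  open import Relation.Nullary.Decidable using (_×-dec_; _⊎-dec_)
  open import Relation.Binary using (Rel; Decidable)
  open import Relation.Binary.Construct.Intersection using (_∩_)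
  import Relation.Binary.Construct.Intersection as Intersection
  open import Relation.Binary.Construct.Union using (_∪_)
  import Relation.Binary.Construct.Union as Union
  open import Relation.Binary.PropositionalEquality using (sym; trans; cong; cong₂; module ≡-Reasoning)
  open import Function using (_∘_)
  open import Function.Bundles using (_⇔_; mk⇔; Equivalence)
  open Equivalence using (to; from)
  open Delay
  open Enumerations
  open Compositions

  ArndtPair : Rel ℕ 0ℓ
  ArndtPair x y = + y ℤ.+ k ℤ.< + x

  arndtPair? : Decidable ArndtPair
  arndtPair? x y = + y ℤ.+ k ℤ.<? + x

  isArndt? : ∀ σ → Dec (IsArndt k σ)
  isArndt? []          = yes tt
  isArndt? (_ ∷ [])    = yes tt
  isArndt? (x ∷ y ∷ ρ) = arndtPair? x y ×-dec isArndt? ρ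

  isComposition? : ∀ n σ → Dec (IsComposition n σ)
  isComposition? n σ = all? (0 <?_) σ ×-dec (sum σ ≟ n)

  enumerate-arndt : ∀ n → Enumeration (IsArndtComposition k n)
  enumerate-arndt n =
    enumerate-filter (λ σ → isComposition? n σ ×-dec isArndt? σ) (λ _ → proj₁) (enumerate-compositions n)

  arndt : ℕ → ℤ
  arndt n = + size (enumerate-arndt n)

  FirstPair : Rel ℕ 0ℓ → List ℕ → Set
  FirstPair Π (x ∷ y ∷ ρ) = Π x y × IsArndt k ρ
  FirstPair Π _           = ⊥

  -- The generating function of StartsWith Π is (Σ_{(x,y) ∈ Π} z^(x+y)) · Σ a_k(n) zⁿ.
  StartsWith : Rel ℕ 0ℓ → ℕ → List ℕ → Set
  StartsWith Π n σ = IsComposition n σ × FirstPair Π σ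

  module _ {Π : Rel ℕ 0ℓ} (Π? : Decidable Π) where

    firstPair? : ∀ σ → Dec (FirstPair Π σ)
    firstPair? []          = no λ ()
    firstPair? (_ ∷ [])    = no λ ()
    firstPair? (x ∷ y ∷ ρ) = Π? x y ×-dec isArndt? ρ

    enumerate-startsWith : ∀ n → Enumeration (StartsWith Π n)
    enumerate-startsWith n =
      enumerate-filter (λ σ → isComposition? n σ ×-dec firstPair? σ) (λ _ → proj₁) (enumerate-compositions n)

    count : ℕ → ℤ
    count n = + size (enumerate-startsWith n)

    count-enumeration : ∀ {n} (e : Enumeration (StartsWith Π n)) → count n ≡ + size e
    count-enumeration e = cong +_ (size-unique (enumerate-startsWith _) e)

  startsWith-map : ∀ {Π Π′ : Rel ℕ 0ℓ} → (∀ {x y} → 0 < x → 0 < y → Π x y → Π′ x y) →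
                   ∀ {n σ} → StartsWith Π n σ → StartsWith Π′ n σ
  startsWith-map Π⇒Π′ {σ = _ ∷ _ ∷ _} (c@(x>0 ∷ y>0 ∷ _ , _) , Πxy , ρ-arndt) = c , Π⇒Π′ x>0 y>0 Πxy , ρ-arndt

  module _ {Π Π′ : Rel ℕ 0ℓ} (Π? : Decidable Π) (Π′? : Decidable Π′) where

    count-⇔ : (∀ x y → 0 < x → 0 < y → Π x y ⇔ Π′ x y) → ∀ n → count Π? n ≡ count Π′? n
    count-⇔ Π⇔Π′ n = count-enumeration Π? (enumerate-⇔ startsWith⇔ (enumerate-startsWith Π′? n))
      where
      startsWith⇔ : ∀ σ → StartsWith Π′ n σ ⇔ StartsWith Π n σ
      startsWith⇔ σ = mk⇔ (startsWith-map λ x>0 y>0 → from (Π⇔Π′ _ _ x>0 y>0))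
                          (startsWith-map λ x>0 y>0 → to (Π⇔Π′ _ _ x>0 y>0))

    count-∪ : (∀ x y → Π x y → ¬ Π′ x y) → ∀ n →
              count (Union.decidable Π? Π′?) n ≡ count Π? n ℤ.+ count Π′? n
    count-∪ Π∩Π′=∅ n =
      trans (count-enumeration (Union.decidable Π? Π′?) (enumerate-⇔ startsWith⇔ (enumerate-⊎ disjoint e e′)))
            (cong +_ (size-⊎ disjoint e e′))
      where
      disjoint : ∀ σ → StartsWith Π n σ → ¬ StartsWith Π′ n σ
      disjoint (x ∷ y ∷ _) (_ , Πxy , _) (_ , Π′xy , _) = Π∩Π′=∅ x y Πxy Π′xy
      e : Enumeration (StartsWith Π n)
      e = enumerate-startsWith Π? n
      e′ : Enumeration (StartsWith Π′ n)
      e′ = enumerate-startsWith Π′? n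
      split : ∀ {σ} → StartsWith (Π ∪ Π′) n σ → StartsWith Π n σ ⊎ StartsWith Π′ n σ
      split {_ ∷ _ ∷ _} (c , inj₁ Πxy  , ρ-arndt) = inj₁ (c , Πxy , ρ-arndt)
      split {_ ∷ _ ∷ _} (c , inj₂ Π′xy , ρ-arndt) = inj₂ (c , Π′xy , ρ-arndt)
      startsWith⇔ : ∀ σ → (StartsWith Π n σ ⊎ StartsWith Π′ n σ) ⇔ StartsWith (Π ∪ Π′) n σ
      startsWith⇔ σ = mk⇔ [ startsWith-map (λ _ _ → inj₁) , startsWith-map (λ _ _ → inj₂) ] split

  positive-difference : ∀ {m n} → m < n → ∃ λ o → 0 < o × n ≡ m + o
  positive-difference {m} {n} m<n = n ∸ m , m<n⇒0<n∸m m<n , sym (m+[n∸m]≡n (<⇒≤ m<n))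

  shiftPair : ℕ → ℕ → List ℕ → List ℕ
  shiftPair dx dy (x ∷ y ∷ ρ) = dx + x ∷ dy + y ∷ ρ
  shiftPair dx dy σ           = σ

  shiftPair-injective : ∀ dx dy {σ τ} → shiftPair dx dy σ ≡ shiftPair dx dy τ → σ ≡ τ
  shiftPair-injective dx dy {σ} {τ} eq =
    trans (sym (unshift∘shift σ)) (trans (cong unshift eq) (unshift∘shift τ))
    where
    unshift : List ℕ → List ℕ
    unshift (x ∷ y ∷ ρ) = x ∸ dx ∷ y ∸ dy ∷ ρ
    unshift σ           = σ
    unshift∘shift : ∀ σ → unshift (shiftPair dx dy σ) ≡ σ
    unshift∘shift []          = refl
    unshift∘shift (_ ∷ [])    = refl
    unshift∘shift (x ∷ y ∷ ρ) = cong₂ _∷_ (m+n∸m≡n dx x) (cong (_∷ ρ) (m+n∸m≡n dy y))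

  sum-shiftPair : ∀ dx dy x y s → (dx + x) + ((dy + y) + s) ≡ (dx + dy) + (x + (y + s))
  sum-shiftPair = solve-∀

  module _ {Π Π′ : Rel ℕ 0ℓ} (Π? : Decidable Π) (Π′? : Decidable Π′) where

    count-shift : ∀ dx dy → (∀ x y → 0 < x → 0 < y → Π (dx + x) (dy + y) ⇔ Π′ x y) →
                  (∀ x y → Π x y → dx < x × dy < y) →
                  ∀ n → count Π? n ≡ delay (dx + dy) (count Π′?) n
    count-shift dx dy shifted⇔ Π-above =
      size-reindex (shiftPair dx dy) (shiftPair-injective dx dy) (dx + dy) reindex
                   (enumerate-startsWith Π?) (enumerate-startsWith Π′?)
      where
      unshifted : ∀ {n σ} → StartsWith Π n σ →
                  ∃₂ λ r τ → n ≡ (dx + dy) + r × StartsWith Π′ r τ × σ ≡ shiftPair dx dy τ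
      unshifted {σ = x ∷ y ∷ ρ} ((_ ∷ _ ∷ ρ>0 , Σσ) , Πxy , ρ-arndt)
        with Π-above x y Πxy
      ... | dx<x , dy<y with positive-difference dx<x | positive-difference dy<y
      ...   | x′ , x′>0 , refl | y′ , y′>0 , refl =
        x′ + (y′ + sum ρ) , x′ ∷ y′ ∷ ρ ,
        trans (sym Σσ) (sum-shiftPair dx dy x′ y′ (sum ρ)) ,
        ((x′>0 ∷ y′>0 ∷ ρ>0 , refl) , to (shifted⇔ x′ y′ x′>0 y′>0) Πxy , ρ-arndt) , refl
      shifted : ∀ {r τ} → StartsWith Π′ r τ → StartsWith Π ((dx + dy) + r) (shiftPair dx dy τ)
      shifted {τ = x ∷ y ∷ ρ} ((x>0 ∷ y>0 ∷ ρ>0 , refl) , Π′xy , ρ-arndt) =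
        (m≤n⇒m≤o+n dx x>0 ∷ m≤n⇒m≤o+n dy y>0 ∷ ρ>0 , sum-shiftPair dx dy x y (sum ρ)) ,
        from (shifted⇔ x y x>0 y>0) Π′xy , ρ-arndt
      reindex : ∀ n σ → StartsWith Π n σ ⇔
                (∃₂ λ r τ → n ≡ (dx + dy) + r × StartsWith Π′ r τ × σ ≡ shiftPair dx dy τ)
      reindex n _ = mk⇔ unshifted λ { (r , τ , refl , Π′τ , refl) → shifted Π′τ }

  At : ℕ → ℕ → Rel ℕ 0ℓ
  At x₀ y₀ x y = x ≡ x₀ × y ≡ y₀

  at? : ∀ x₀ y₀ → Decidable (At x₀ y₀)
  at? x₀ y₀ x y = (x ≟ x₀) ×-dec (y ≟ y₀)

  count-at : ∀ {x₀ y₀} → 0 < x₀ → 0 < y₀ → ∀ n → count (at? x₀ y₀) n ≡ delay (x₀ + y₀) arndt n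
  count-at {x₀} {y₀} x₀>0 y₀>0 =
    size-reindex (λ τ → x₀ ∷ y₀ ∷ τ) (λ { refl → refl }) (x₀ + y₀) reindex
                 (enumerate-startsWith (at? x₀ y₀)) enumerate-arndt
    where
    reindex : ∀ n σ → StartsWith (At x₀ y₀) n σ ⇔
              (∃₂ λ r τ → n ≡ (x₀ + y₀) + r × IsArndtComposition k r τ × σ ≡ x₀ ∷ y₀ ∷ τ)
    reindex n _ = mk⇔ prefixed (λ { (r , τ , refl , τ-arndt , refl) → extended τ-arndt })
      where
      prefixed : ∀ {σ} → StartsWith (At x₀ y₀) n σ →
                 ∃₂ λ r τ → n ≡ (x₀ + y₀) + r × IsArndtComposition k r τ × σ ≡ x₀ ∷ y₀ ∷ τ
      prefixed {_ ∷ _ ∷ ρ} ((_ ∷ _ ∷ ρ>0 , Σσ) , (refl , refl) , ρ-arndt) =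
        sum ρ , ρ , trans (sym Σσ) (sym (+-assoc x₀ y₀ (sum ρ))) , ((ρ>0 , refl) , ρ-arndt) , refl
      extended : ∀ {r τ} → IsArndtComposition k r τ → StartsWith (At x₀ y₀) ((x₀ + y₀) + r) (x₀ ∷ y₀ ∷ τ)
      extended {τ = τ} ((τ>0 , refl) , τ-arndt) =
        (x₀>0 ∷ y₀>0 ∷ τ>0 , sym (+-assoc x₀ y₀ (sum τ))) , (refl , refl) , τ-arndt

  single : ℕ → List ℕ
  single zero    = []
  single (suc n) = suc n ∷ []

  arndt≡1+count : ∀ n → arndt n ≡ 1ℤ ℤ.+ count arndtPair? n
  arndt≡1+count n =
    cong +_ (trans (size-unique (enumerate-arndt n) (enumerate-⇔ arndt⇔ (enumerate-⊎ not-paired singleton paired)))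
                   (size-⊎ not-paired singleton paired))
    where
    singleton : Enumeration (_≡ single n)
    singleton = single n ∷ [] , [] ∷ [] , λ σ → mk⇔ (λ { (here σ≡) → σ≡ ; (there ()) }) here
    not-paired : ∀ {m} σ → σ ≡ single m → ¬ StartsWith ArndtPair m σ
    not-paired {zero}  _ refl (_ , ())
    not-paired {suc _} _ refl (_ , ())
    paired : Enumeration (StartsWith ArndtPair n)
    paired = enumerate-startsWith arndtPair? n
    single-arndt : ∀ m → IsArndtComposition k m (single m)
    single-arndt zero    = ([] , refl) , tt
    single-arndt (suc m) = (s≤s z≤n ∷ [] , cong suc (+-identityʳ m)) , tt
    classify : ∀ {σ} → IsArndtComposition k n σ → σ ≡ single n ⊎ StartsWith ArndtPair n σ
    classify {[]}          (([] , refl) , _)     = inj₁ refl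
    classify {zero ∷ []}   ((() ∷ [] , _) , _)
    classify {suc x ∷ []}  ((_ ∷ [] , refl) , _) = inj₁ (cong (λ z → suc z ∷ []) (sym (+-identityʳ x)))
    classify {_ ∷ _ ∷ _}   (c , pair-arndt)      = inj₂ (c , pair-arndt)
    arndt⇔ : ∀ σ → (σ ≡ single n ⊎ StartsWith ArndtPair n σ) ⇔ IsArndtComposition k n σ
    arndt⇔ σ = mk⇔ [ (λ { refl → single-arndt n }) , pair-arndt ] classify
      where
      pair-arndt : ∀ {σ} → StartsWith ArndtPair n σ → IsArndtComposition k n σ
      pair-arndt {_ ∷ _ ∷ _} (c , arndt-σ) = c , arndt-σ

  Edge : Rel ℕ 0ℓ
  Edge x y = x ≡ 1 ⊎ y ≡ 1

  edge? : Decidable Edge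
  edge? x y = (x ≟ 1) ⊎-dec (y ≟ 1)

  Interior : Rel ℕ 0ℓ
  Interior x y = 1 < x × 1 < y

  interior? : Decidable Interior
  interior? x y = (1 <? x) ×-dec (1 <? y)

  -- Removing the first row and column maps Π ∩ Interior bijectively onto Π.
  count-diagonal : ∀ {Π} (Π? : Decidable Π) → (∀ x y → Π (suc x) (suc y) ⇔ Π x y) →
                   ∀ n → count Π? n ≡ delay 2 (count Π?) n ℤ.+ count (Intersection.decidable Π? edge?) n
  count-diagonal {Π} Π? Π-diagonal n = begin
    count Π? n
      ≡⟨ count-⇔ Π? (Union.decidable inner? outer?) interior-or-edge n ⟩
    count (Union.decidable inner? outer?) n
      ≡⟨ count-∪ inner? outer? (λ { _ _ (_ , 1<x , 1<y) (_ , edge) → not-both 1<x 1<y edge }) n ⟩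
    count inner? n ℤ.+ count outer? n
      ≡⟨ cong (ℤ._+ count outer? n) (count-shift inner? Π? 1 1 peeled (λ _ _ → proj₂) n) ⟩
    delay 2 (count Π?) n ℤ.+ count outer? n ∎
    where
    open ≡-Reasoning
    inner? : Decidable (Π ∩ Interior)
    inner? = Intersection.decidable Π? interior?
    outer? : Decidable (Π ∩ Edge)
    outer? = Intersection.decidable Π? edge?
    not-both : ∀ {x y} → 1 < x → 1 < y → ¬ Edge x y
    not-both (s≤s ()) _ (inj₁ refl)
    not-both _ (s≤s ()) (inj₂ refl)
    interior-or-edge : ∀ x y → 0 < x → 0 < y → Π x y ⇔ ((Π ∩ Interior) ∪ (Π ∩ Edge)) x y
    interior-or-edge x y x>0 y>0 = mk⇔ (classify x y x>0 y>0) [ proj₁ , proj₁ ]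
      where
      classify : ∀ x y → 0 < x → 0 < y → Π x y → ((Π ∩ Interior) ∪ (Π ∩ Edge)) x y
      classify 1             y             _ _ Πxy = inj₂ (Πxy , inj₁ refl)
      classify (suc (suc _)) 1             _ _ Πxy = inj₂ (Πxy , inj₂ refl)
      classify (suc (suc _)) (suc (suc _)) _ _ Πxy = inj₁ (Πxy , s≤s (s≤s z≤n) , s≤s (s≤s z≤n))
    peeled : ∀ x y → 0 < x → 0 < y → (Π ∩ Interior) (1 + x) (1 + y) ⇔ Π x y
    peeled x y x>0 y>0 =
      mk⇔ (to (Π-diagonal x y) ∘ proj₁) (λ Πxy → from (Π-diagonal x y) Πxy , s≤s x>0 , s≤s y>0)

  Row : ℕ → Rel ℕ 0ℓ
  Row x₀ x y = y ≡ 1 × x₀ ≤ x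

  row? : ∀ x₀ → Decidable (Row x₀)
  row? x₀ x y = (y ≟ 1) ×-dec (x₀ ≤? x)

  -- Rows and columns are each their first point plus a translate of themselves.
  count-row : ∀ {x₀} → 0 < x₀ → ∀ n →
              count (row? x₀) n ≡ delay (x₀ + 1) arndt n ℤ.+ delay 1 (count (row? x₀)) n
  count-row {x₀} x₀>0 n = begin
    count (row? x₀) n
      ≡⟨ count-⇔ (row? x₀) corner∪rest? corner-or-rest n ⟩
    count corner∪rest? n
      ≡⟨ count-∪ (at? x₀ 1) (row? (suc x₀)) (λ { _ _ (refl , _) (_ , x₀<x₀) → <-irrefl refl x₀<x₀ }) n ⟩
    count (at? x₀ 1) n ℤ.+ count (row? (suc x₀)) n
      ≡⟨ cong₂ ℤ._+_ (count-at x₀>0 (s≤s z≤n) n) (count-shift (row? (suc x₀)) (row? x₀) 1 0 shifted above n) ⟩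
    delay (x₀ + 1) arndt n ℤ.+ delay 1 (count (row? x₀)) n ∎
    where
    open ≡-Reasoning
    corner∪rest? : Decidable (At x₀ 1 ∪ Row (suc x₀))
    corner∪rest? = Union.decidable (at? x₀ 1) (row? (suc x₀))
    corner-or-rest : ∀ x y → 0 < x → 0 < y → Row x₀ x y ⇔ (At x₀ 1 ∪ Row (suc x₀)) x y
    corner-or-rest x y _ _ = mk⇔
      (λ (y≡1 , x₀≤x) → [ (λ x₀<x → inj₂ (y≡1 , x₀<x)) , (λ x₀≡x → inj₁ (sym x₀≡x , y≡1)) ]
                          (m≤n⇒m<n∨m≡n x₀≤x))
      [ (λ { (refl , y≡1) → y≡1 , ≤-refl }) , (λ (y≡1 , x₀<x) → y≡1 , <⇒≤ x₀<x) ]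
    shifted : ∀ x y → 0 < x → 0 < y → Row (suc x₀) (1 + x) (0 + y) ⇔ Row x₀ x y
    shifted x y _ _ = mk⇔ (λ { (y≡1 , s≤s x₀≤x) → y≡1 , x₀≤x }) (λ (y≡1 , x₀≤x) → y≡1 , s≤s x₀≤x)
    above : ∀ x y → Row (suc x₀) x y → 1 < x × 0 < y
    above x y (refl , x₀<x) = ≤-trans (s≤s x₀>0) x₀<x , s≤s z≤n

  Column : ℕ → Rel ℕ 0ℓ
  Column y₀ x y = x ≡ 1 × y₀ ≤ y

  column? : ∀ y₀ → Decidable (Column y₀)
  column? y₀ x y = (x ≟ 1) ×-dec (y₀ ≤? y)

  count-column : ∀ {y₀} → 0 < y₀ → ∀ n →
                 count (column? y₀) n ≡ delay (1 + y₀) arndt n ℤ.+ delay 1 (count (column? y₀)) n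
  count-column {y₀} y₀>0 n = begin
    count (column? y₀) n
      ≡⟨ count-⇔ (column? y₀) corner∪rest? corner-or-rest n ⟩
    count corner∪rest? n
      ≡⟨ count-∪ (at? 1 y₀) (column? (suc y₀)) (λ { _ _ (_ , refl) (_ , y₀<y₀) → <-irrefl refl y₀<y₀ }) n ⟩
    count (at? 1 y₀) n ℤ.+ count (column? (suc y₀)) n
      ≡⟨ cong₂ ℤ._+_ (count-at (s≤s z≤n) y₀>0 n) (count-shift (column? (suc y₀)) (column? y₀) 0 1 shifted above n) ⟩
    delay (1 + y₀) arndt n ℤ.+ delay 1 (count (column? y₀)) n ∎
    where
    open ≡-Reasoning
    corner∪rest? : Decidable (At 1 y₀ ∪ Column (suc y₀))
    corner∪rest? = Union.decidable (at? 1 y₀) (column? (suc y₀))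
    corner-or-rest : ∀ x y → 0 < x → 0 < y → Column y₀ x y ⇔ (At 1 y₀ ∪ Column (suc y₀)) x y
    corner-or-rest x y _ _ = mk⇔
      (λ (x≡1 , y₀≤y) → [ (λ y₀<y → inj₂ (x≡1 , y₀<y)) , (λ y₀≡y → inj₁ (x≡1 , sym y₀≡y)) ]
                          (m≤n⇒m<n∨m≡n y₀≤y))
      [ (λ { (x≡1 , refl) → x≡1 , ≤-refl }) , (λ (x≡1 , y₀<y) → x≡1 , <⇒≤ y₀<y) ]
    shifted : ∀ x y → 0 < x → 0 < y → Column (suc y₀) (0 + x) (1 + y) ⇔ Column y₀ x y
    shifted x y _ _ = mk⇔ (λ { (x≡1 , s≤s y₀≤y) → x≡1 , y₀≤y }) (λ (x≡1 , y₀≤y) → x≡1 , s≤s y₀≤y)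
    above : ∀ x y → Column (suc y₀) x y → 0 < x × 1 < y
    above x y (refl , y₀<y) = s≤s z≤n , ≤-trans (s≤s y₀>0) y₀<y

module Convolution where

  open import Data.Nat using (zero; suc; _∸_; _≡ᵇ_)
  open import Data.Integer using (0ℤ; 1ℤ; _+_; _*_; _-_)
  open import Data.Integer.Properties using (*-zeroˡ; *-zeroʳ; +-identityˡ; +-identityʳ; *-distribʳ-+)
  open import Data.List using ([]; _∷_; applyUpTo)
  open import Data.List.Properties using (map-upTo)
  open import Data.Bool using (if_then_else_)
  open import Function using (_∘_)
  open import Relation.Binary.PropositionalEquality using (sym; trans; cong; cong₂; module ≡-Reasoning)
  open Delay

  applyPoly : Poly → (ℕ → ℤ) → ℕ → ℤ
  applyPoly []            F n = 0ℤ
  applyPoly ((c , e) ∷ p) F n = c * delay e F n + applyPoly p F n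

  Σ< : ℕ → (ℕ → ℤ) → ℤ
  Σ< m f = sumℤ (applyUpTo f m)

  Σ<-zero : ∀ m {f} → (∀ j → f j ≡ 0ℤ) → Σ< m f ≡ 0ℤ
  Σ<-zero zero    f≡0 = refl
  Σ<-zero (suc m) f≡0 = cong₂ _+_ (f≡0 0) (Σ<-zero m (f≡0 ∘ suc))

  Σ<-cong : ∀ m {f g} → (∀ j → f j ≡ g j) → Σ< m f ≡ Σ< m g
  Σ<-cong zero    f≗g = refl
  Σ<-cong (suc m) f≗g = cong₂ _+_ (f≗g 0) (Σ<-cong m (λ j → f≗g (suc j)))

  Σ<-+ : ∀ m f g → Σ< m (λ j → f j + g j) ≡ Σ< m f + Σ< m g
  Σ<-+ zero    f g = refl
  Σ<-+ (suc m) f g =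
    trans (cong (λ s → f 0 + g 0 + s) (Σ<-+ m (λ j → f (suc j)) (λ j → g (suc j))))
          (interchange (f 0) (g 0) (Σ< m (λ j → f (suc j))) (Σ< m (λ j → g (suc j))))
    where
    open import Data.Integer.Tactic.RingSolver using (solve-∀)
    interchange : ∀ a b c d → a + b + (c + d) ≡ a + c + (b + d)
    interchange = solve-∀

  Σ<-monomial : ∀ c e n F → Σ< (suc n) (λ j → (if e ≡ᵇ j then c else 0ℤ) * F (n ∸ j)) ≡ c * delay e F n
  Σ<-monomial c zero    n       F =
    trans (cong (λ s → c * F n + s) (Σ<-zero n (λ j → *-zeroˡ (F (n ∸ suc j))))) (+-identityʳ _)
  Σ<-monomial c (suc e) zero    F = trans (+-identityʳ _) (trans (*-zeroˡ (F 0)) (sym (*-zeroʳ c)))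
  Σ<-monomial c (suc e) (suc n) F =
    trans (cong (_+ Σ< (suc n) (λ j → (if e ≡ᵇ j then c else 0ℤ) * F (n ∸ j))) (*-zeroˡ (F (suc n))))
          (trans (+-identityˡ _) (Σ<-monomial c e n F))

  convCoeff≡applyPoly : ∀ p a n → convCoeff p a n ≡ applyPoly p (λ i → + a i) n
  convCoeff≡applyPoly p a n = trans (cong sumℤ (map-upTo (λ j → coeff p j * A (n ∸ j)) (suc n))) (Σ<-poly p)
    where
    A : ℕ → ℤ
    A i = + a i
    Σ<-poly : ∀ p → Σ< (suc n) (λ j → coeff p j * A (n ∸ j)) ≡ applyPoly p A n
    Σ<-poly []            = Σ<-zero (suc n) (λ j → *-zeroˡ (A (n ∸ j)))
    Σ<-poly ((c , e) ∷ p) = begin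
      Σ< (suc n) (λ j → coeff ((c , e) ∷ p) j * A (n ∸ j))
        ≡⟨ Σ<-cong (suc n) (λ j → *-distribʳ-+ (A (n ∸ j)) (if e ≡ᵇ j then c else 0ℤ) (coeff p j)) ⟩
      Σ< (suc n) (λ j → (if e ≡ᵇ j then c else 0ℤ) * A (n ∸ j) + coeff p j * A (n ∸ j))
        ≡⟨ Σ<-+ (suc n) (λ j → (if e ≡ᵇ j then c else 0ℤ) * A (n ∸ j)) (λ j → coeff p j * A (n ∸ j)) ⟩
      Σ< (suc n) (λ j → (if e ≡ᵇ j then c else 0ℤ) * A (n ∸ j)) + Σ< (suc n) (λ j → coeff p j * A (n ∸ j))
        ≡⟨ cong₂ _+_ (Σ<-monomial c e n A) (Σ<-poly p) ⟩
      c * delay e A n + applyPoly p A n ∎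
      where open ≡-Reasoning

  one : ℕ → ℤ
  one _ = 1ℤ

  -- 1 − z² = (1 − z − z² + z³) · Σ zⁿ
  coeff-numerator : ∀ n → coeff numerator n ≡ 1ℤ - delay 1 one n - delay 2 one n + delay 3 one n
  coeff-numerator 0                   = refl
  coeff-numerator 1                   = refl
  coeff-numerator 2                   = refl
  coeff-numerator (suc (suc (suc n))) = refl

module SeriesFromRecurrences where

  import Data.Nat as ℕ
  open import Data.Integer using (0ℤ; 1ℤ; _+_; _*_; _-_; -_)
  open import Data.Integer.Tactic.RingSolver using (solve)
  open import Data.List using ([]; _∷_)
  open import Relation.Binary.PropositionalEquality using (sym; trans; cong; cong₂)
  open Delay
  open Convolution

  k≥0 : ∀ K (A C G : ℕ → ℤ) →
        (∀ n → A n ≡ 1ℤ + C n) →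
        (∀ n → C n ≡ delay 2 C n + G n) →
        (∀ n → G n ≡ delay (K ℕ.+ 3) A n + delay 1 G n) →
        ∀ n → applyPoly (denominator (+ K)) A n ≡ coeff numerator n
  k≥0 K A C G A≡1+C C-rec G-rec n =
    trans (eliminate (A n) (delay 1 A n) (delay 2 A n) (delay 3 A n) (delay (K ℕ.+ 3) A n)
                     (delay 1 one n) (delay 2 one n) (delay 3 one n)
                     (C n) (delay 1 C n) (delay 2 C n) (delay 3 C n) (G n) (delay 1 G n)
                     (A≡1+C n) (delay-cong-+ A≡1+C 1 n) (delay-cong-+ A≡1+C 2 n) (delay-cong-+ A≡1+C 3 n)
                     (C-rec n) (trans (delay-cong-+ C-rec 1 n) (cong (_+ delay 1 G n) (delay-delay 1 2 C n)))
                     (G-rec n))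
          (sym (coeff-numerator n))
    where
    -- Matching on refl substitutes each left-hand variable away; a ring identity remains.
    eliminate : ∀ (a₀ a₁ a₂ a₃ aₖ u₁ u₂ u₃ c₀ c₁ c₂ c₃ g₀ g₁ : ℤ) →
                a₀ ≡ 1ℤ + c₀ → a₁ ≡ u₁ + c₁ → a₂ ≡ u₂ + c₂ → a₃ ≡ u₃ + c₃ →
                c₀ ≡ c₂ + g₀ → c₁ ≡ c₃ + g₁ → g₀ ≡ aₖ + g₁ →
                1ℤ * a₀ + (- 1ℤ * a₁ + (- 1ℤ * a₂ + (1ℤ * a₃ + (- 1ℤ * aₖ + 0ℤ)))) ≡ 1ℤ - u₁ - u₂ + u₃
    eliminate _ _ _ _ aₖ u₁ u₂ u₃ _ _ c₂ c₃ _ g₁ refl refl refl refl refl refl refl =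
      solve (aₖ ∷ u₁ ∷ u₂ ∷ u₃ ∷ c₂ ∷ c₃ ∷ g₁ ∷ [])

  k<0 : ∀ m (A C G E H H′ : ℕ → ℤ) →
        (∀ n → A n ≡ 1ℤ + C n) →
        (∀ n → C n ≡ delay 2 C n + (G n + E n)) →
        (∀ n → G n ≡ delay 2 A n + delay 1 G n) →
        (∀ n → H n ≡ E n + H′ n) →
        (∀ n → H n ≡ delay 3 A n + delay 1 H n) →
        (∀ n → H′ n ≡ delay (3 ℕ.+ m) A n + delay 1 H′ n) →
        ∀ n → applyPoly (denominator -[1+ m ]) A n ≡ coeff numerator n
  k<0 m A C G E H H′ A≡1+C C-rec G-rec H≡E+H′ H-rec H′-rec n =
    trans (eliminate (A n) (delay 1 A n) (delay 2 A n) (delay 3 A n) (delay (3 ℕ.+ m) A n)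
                     (delay 1 one n) (delay 2 one n) (delay 3 one n)
                     (C n) (delay 1 C n) (delay 2 C n) (delay 3 C n) (G n) (delay 1 G n) (E n) (delay 1 E n)
                     (H n) (delay 1 H n) (H′ n) (delay 1 H′ n)
                     (A≡1+C n) (delay-cong-+ A≡1+C 1 n) (delay-cong-+ A≡1+C 2 n) (delay-cong-+ A≡1+C 3 n)
                     (C-rec n)
                     (trans (delay-cong-+ C-rec 1 n)
                            (cong₂ _+_ (delay-delay 1 2 C n) (delay-distrib-+ 1 G E n)))
                     (G-rec n)
                     (difference (H≡E+H′ n)) (difference (delay-cong-+ H≡E+H′ 1 n))
                     (H-rec n) (H′-rec n))
          (sym (coeff-numerator n))
    where
    difference : ∀ {x y z} → x ≡ y + z → y ≡ x - z
    difference {y = y} {z} refl = solve (y ∷ z ∷ [])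
    eliminate : ∀ (a₀ a₁ a₂ a₃ aₘ u₁ u₂ u₃ c₀ c₁ c₂ c₃ g₀ g₁ e₀ e₁ h₀ h₁ h′₀ h′₁ : ℤ) →
                a₀ ≡ 1ℤ + c₀ → a₁ ≡ u₁ + c₁ → a₂ ≡ u₂ + c₂ → a₃ ≡ u₃ + c₃ →
                c₀ ≡ c₂ + (g₀ + e₀) → c₁ ≡ c₃ + (g₁ + e₁) → g₀ ≡ a₂ + g₁ →
                e₀ ≡ h₀ - h′₀ → e₁ ≡ h₁ - h′₁ → h₀ ≡ a₃ + h₁ → h′₀ ≡ aₘ + h′₁ →
                1ℤ * a₀ + (- 1ℤ * a₁ + (- 1ℤ * a₂ + (- 1ℤ * a₂ + (1ℤ * aₘ + 0ℤ)))) ≡ 1ℤ - u₁ - u₂ + u₃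
    eliminate _ _ _ _ aₘ u₁ u₂ u₃ _ _ c₂ c₃ _ g₁ _ _ _ h₁ _ h′₁
              refl refl refl refl refl refl refl refl refl refl refl =
      solve (aₘ ∷ u₁ ∷ u₂ ∷ u₃ ∷ c₂ ∷ c₃ ∷ g₁ ∷ h₁ ∷ h′₁ ∷ [])

module Positive (K : ℕ) where

  open import Data.Nat using (suc; _<_; _+_; z≤n; s≤s)
  open import Data.Nat.Properties using (+-comm)
  open import Data.Integer using (+<+)
  import Data.Integer as ℤ
  open import Data.Sum using (inj₁; inj₂)
  open import Relation.Binary.PropositionalEquality using (trans; cong)
  open import Relation.Binary.Construct.Intersection using (_∩_)
  import Relation.Binary.Construct.Intersection as Intersection
  open import Function.Bundles using (_⇔_; mk⇔)
  open Delay
  open Enumerations using (size)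
  open FirstPairs (+ K)
  open Convolution

  arndtPair-diagonal : ∀ x y → ArndtPair (suc x) (suc y) ⇔ ArndtPair x y
  arndtPair-diagonal x y = mk⇔ (λ { (+<+ (s≤s y+K<x)) → +<+ y+K<x }) (λ { (+<+ y+K<x) → +<+ (s≤s y+K<x) })

  arndtPair-edge : ∀ x y → 0 < x → 0 < y → (ArndtPair ∩ Edge) x y ⇔ Row (2 + K) x y
  arndtPair-edge x y _ (s≤s z≤n) = mk⇔ (λ { (+<+ (s≤s ()) , inj₁ refl) ; (+<+ 1+K<x , inj₂ refl) → refl , 1+K<x })
                                        (λ { (refl , 2+K≤x) → +<+ 2+K≤x , inj₂ refl })

  generating-function : ∀ n → convCoeff (denominator (+ K)) (λ n → size (enumerate-arndt n)) n ≡ coeff numerator n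
  generating-function n =
    trans (convCoeff≡applyPoly (denominator (+ K)) (λ n → size (enumerate-arndt n)) n)
          (SeriesFromRecurrences.k≥0 K arndt (count arndtPair?) (count (row? (2 + K)))
                         arndt≡1+count count-arndtPair first-row n)
    where
    count-arndtPair : ∀ n → count arndtPair? n ≡ delay 2 (count arndtPair?) n ℤ.+ count (row? (2 + K)) n
    count-arndtPair n = trans (count-diagonal arndtPair? arndtPair-diagonal n)
                          (cong (λ c → delay 2 (count arndtPair?) n ℤ.+ c)
                                (count-⇔ (Intersection.decidable arndtPair? edge?) (row? (2 + K)) arndtPair-edge n))
    first-row : ∀ n → count (row? (2 + K)) n ≡ delay (K + 3) arndt n ℤ.+ delay 1 (count (row? (2 + K))) n
    first-row n = trans (count-row (s≤s z≤n) n)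
                        (cong (λ j → delay j arndt n ℤ.+ delay 1 (count (row? (2 + K))) n)
                              (trans (+-comm (2 + K) 1) (+-comm 3 K)))

module Negative (m : ℕ) where

  open import Level using (0ℓ)
  open import Data.Nat using (suc; _<_; _+_; z≤n; s≤s; _≟_; _<?_)
  open import Data.Nat.Properties using (≤-pred; +-mono-≤; <-≤-connex; <⇒≱; ≤-trans; m≤m+n)
  open import Data.Integer using (+<+; -_)
  open import Data.Integer.Properties using (drop‿+<+; +-monoˡ-<)
  open import Data.Integer.Tactic.RingSolver using (solve-∀)
  import Data.Integer as ℤ
  open import Data.Sum using (inj₁; inj₂; [_,_]; [_,_]′)
  open import Relation.Nullary.Decidable using (_×-dec_)
  open import Relation.Binary using (Rel; Decidable)
  open import Relation.Binary.PropositionalEquality using (trans; cong; subst)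
  open import Relation.Binary.Construct.Intersection using (_∩_)
  import Relation.Binary.Construct.Intersection as Intersection
  open import Relation.Binary.Construct.Union using (_∪_)
  import Relation.Binary.Construct.Union as Union
  open import Function.Bundles using (_⇔_; mk⇔; Equivalence)
  open Equivalence using (to; from)
  open Delay
  open Enumerations using (size)
  open FirstPairs -[1+ m ]
  open Convolution

  arndtPair⇔ : ∀ {x y} → ArndtPair x y ⇔ y < x + suc m
  arndtPair⇔ {x} {y} = mk⇔
    (λ y-1-m<x → drop‿+<+ (subst (ℤ._< + (x + suc m)) (cancelʳ (+ y) (+ suc m)) (+-monoˡ-< (+ suc m) y-1-m<x)))
    (λ y<x+1+m → subst (+ y ℤ.+ -[1+ m ] ℤ.<_) (cancelˡ (+ x) (+ suc m)) (+-monoˡ-< -[1+ m ] (+<+ y<x+1+m)))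
    where
    cancelʳ : ∀ i c → i ℤ.+ - c ℤ.+ c ≡ i
    cancelʳ = solve-∀
    cancelˡ : ∀ i c → i ℤ.+ c ℤ.+ - c ≡ i
    cancelˡ = solve-∀

  arndtPair-diagonal : ∀ x y → ArndtPair (suc x) (suc y) ⇔ ArndtPair x y
  arndtPair-diagonal x y = mk⇔ (λ p → from arndtPair⇔ (≤-pred (to arndtPair⇔ p)))
                               (λ p → from arndtPair⇔ (s≤s (to arndtPair⇔ p)))

  Segment : Rel ℕ 0ℓ
  Segment x y = x ≡ 1 × 1 < y × y < 2 + m

  segment? : Decidable Segment
  segment? x y = (x ≟ 1) ×-dec (1 <? y) ×-dec (y <? 2 + m)

  arndtPair-edge : ∀ x y → 0 < x → 0 < y → (ArndtPair ∩ Edge) x y ⇔ (Row 1 ∪ Segment) x y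
  arndtPair-edge x y x>0 y>0 = mk⇔ (classify x y x>0 y>0)
    [ (λ { (refl , 1≤x) → from arndtPair⇔ (+-mono-≤ 1≤x (s≤s z≤n)) , inj₂ refl })
    , (λ { (refl , _ , y<2+m) → from arndtPair⇔ y<2+m , inj₁ refl }) ]
    where
    classify : ∀ x y → 0 < x → 0 < y → (ArndtPair ∩ Edge) x y → (Row 1 ∪ Segment) x y
    classify x           _             x>0 _ (_ , inj₂ refl) = inj₁ (refl , x>0)
    classify _           1             _   _ (_ , inj₁ refl) = inj₁ (refl , s≤s z≤n)
    classify _           (suc (suc _)) _   _ (p , inj₁ refl) = inj₂ (refl , s≤s (s≤s z≤n) , to arndtPair⇔ p)

  column-2-split : ∀ x y → 0 < x → 0 < y → Column 2 x y ⇔ (Segment ∪ Column (2 + m)) x y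
  column-2-split x y _ _ = mk⇔
    (λ (x≡1 , 2≤y) → [ (λ y<2+m → inj₁ (x≡1 , 2≤y , y<2+m)) , (λ 2+m≤y → inj₂ (x≡1 , 2+m≤y)) ]′
                        (<-≤-connex y (2 + m)))
    [ (λ (x≡1 , 1<y , _) → x≡1 , 1<y) , (λ (x≡1 , 2+m≤y) → x≡1 , ≤-trans (m≤m+n 2 m) 2+m≤y) ]

  generating-function : ∀ n → convCoeff (denominator -[1+ m ]) (λ n → size (enumerate-arndt n)) n ≡ coeff numerator n
  generating-function n =
    trans (convCoeff≡applyPoly (denominator -[1+ m ]) (λ n → size (enumerate-arndt n)) n)
          (SeriesFromRecurrences.k<0 m arndt (count arndtPair?) (count (row? 1)) (count segment?)
                         (count (column? 2)) (count (column? (2 + m)))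
                         arndt≡1+count count-arndtPair (count-row (s≤s z≤n)) count-column-2
                         (count-column (s≤s z≤n)) (count-column (s≤s z≤n)) n)
    where
    count-arndtPair : ∀ n → count arndtPair? n ≡
                            delay 2 (count arndtPair?) n ℤ.+ (count (row? 1) n ℤ.+ count segment? n)
    count-arndtPair n =
      trans (count-diagonal arndtPair? arndtPair-diagonal n)
            (cong (λ c → delay 2 (count arndtPair?) n ℤ.+ c)
                  (trans (count-⇔ (Intersection.decidable arndtPair? edge?) (Union.decidable (row? 1) segment?)
                                  arndtPair-edge n)
                         (count-∪ (row? 1) segment? (λ { _ _ (refl , _) (_ , s≤s () , _) }) n)))
    count-column-2 : ∀ n → count (column? 2) n ≡ count segment? n ℤ.+ count (column? (2 + m)) n
    count-column-2 n =
      trans (count-⇔ (column? 2) (Union.decidable segment? (column? (2 + m))) column-2-split n)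
            (count-∪ segment? (column? (2 + m)) (λ { _ _ (_ , _ , y<2+m) (_ , 2+m≤y) → <⇒≱ y<2+m 2+m≤y }) n)

open Enumerations using (size)
open FirstPairs using (enumerate-arndt)

generating-function : ∀ k n → convCoeff (denominator k) (λ n → size (enumerate-arndt k n)) n ≡ coeff numerator n
generating-function (+ K)    = Positive.generating-function K
generating-function -[1+ m ] = Negative.generating-function m

corollary4p2 : (k : ℤ) →
    Σ (ℕ → ℕ) λ a →
      (∀ n → IsArndtCount k n (a n)) ×
      (∀ n → convCoeff (denominator k) a n ≡ coeff numerator n)
corollary4p2 k =
  (λ n → size (enumerate-arndt k n)) ,
  (λ n → let (L , L! , ∈L) = enumerate-arndt k n in L , L! , ∈L , refl) ,
  generating-function k
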